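{- Let $\Gamma_1=(G_1,\sigma_1,\mu_1)$ and $\Gamma_2=(G_2,\sigma_2,\mu_2)$ be vertex-disjoint signed graphs. Then the duplication add vertex corona $\Gamma_1\circledast\Gamma_2$ and the duplication vertex corona $\Gamma_1\circledcirc\Gamma_2$ are switching isomorphic, i.e. there is an isomorphism $f$ of the underlying graphs and a function $\theta:V(\Gamma_1\circledast\Gamma_2)\to\{+1,-1\}$ such that $\theta(u)\,\sigma_{\Gamma_1\circledast\Gamma_2}(uv)\,\theta(v)=\sigma_{\Gamma_1\circledcirc\Gamma_2}(f(u)f(v))$ for every edge $uv$ of $\Gamma_1\circledast\Gamma_2$.
   Context: A signed graph is $\Gamma=(G,\sigma,\mu)$ with $G$ a finite simple graph, $\sigma:E(G)\to\{\pm1\}$ a signature and $\mu:V(G)\to\{\pm1\}$ a marking (canonically $\mu(u)=\prod_{e\ni u}\sigma(e)$). Duplication signed graph $D\Gamma_1$: if $V(\Gamma_1)=\{u_1,\dots,u_{n_1}\}$, add new vertices $a_1,\dots,a_{n_1}$ with $\mu_1(a_i)=\mu_1(u_i)$; $D\Gamma_1$ has vertex set $\{u_i\}\cup\{a_i\}$ and, for every edge $u_iu_j$ of $G_1$, an edge $a_iu_j$ of sign $\mu_1(a_i)\mu_1(u_j)$, and no other edges. Let $V(\Gamma_2)=\{v_1,\dots,v_{n_2}\}$. The duplication add vertex corona $\Gamma_1\circledast\Gamma_2$ is obtained from $D\Gamma_1$ and $n_1$ disjoint copies of $\Gamma_2$ (the $i$-th copy with vertices $v^i_1,\dots,v^i_{n_2}$,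 signature copied from $\sigma_2$ and marking $\mu_2(v^i_j)=\mu_2(v_j)$) by joining $a_i$ to every vertex $v^i_j$ of the $i$-th copy, with edge sign $\mu_1(a_i)\mu_2(v_j)$, for $i=1,\dots,n_1$. The duplication vertex corona $\Gamma_1\circledcirc\Gamma_2$ is obtained in the same way except that $u_i$ (instead of $a_i$) is joined to every vertex of the $i$-th copy of $\Gamma_2$, with edge sign $\mu_1(u_i)\mu_2(v_j)$. -}

module Defs where

open import Data.Nat using (ℕ)
open import Data.Bool using (Bool; true; false; _∧_)
open import Data.Bool.Properties using (∧-comm)
open import Data.Fin using (Fin; _≟_)
open import Data.Fin.Properties using ()
open import Data.Sign using (Sign) renaming (_*_ to _·_)
open import Data.Sign.Properties using (*-comm)
open import Data.Product using (Σ; _×_; _,_)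
open import Relation.Nullary.Decidable using (⌊_⌋)
open import Relation.Binary.PropositionalEquality using (_≡_; refl; sym; cong; cong₂)
import Relation.Nullary
import Data.Empty
open import Function.Bundles using (_↔_; Inverse)

-- G is a simple graph given by a Boolean adjacency relation (symmetric,
-- irreflexive); σ assigns a sign to every ordered pair, but only its values on
-- edges matter, where it is required to be symmetric (σ(uv) = σ(vu));
-- μ is a marking of the vertices.
record SignedGraph (V : Set) : Set where
  field
    adj     : V → V → Bool
    adj-sym : ∀ x y → adj x y ≡ adj y x
    adj-irr : ∀ x → adj x x ≡ false
    σ       : V → V → Sign
    σ-sym   : ∀ x y → adj x y ≡ true → σ x y ≡ σ y x
    μ       : V → Sign
open SignedGraph public

SwitchingIsomorphic : {V W : Set} → SignedGraph V → SignedGraph W → Set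
SwitchingIsomorphic {V} {W} Γ Δ =
  Σ (V ↔ W) λ f →
    let g = Inverse.to f in
    (∀ x y → adj Δ (g x) (g y) ≡ adj Γ x y) ×
    Σ (V → Sign) λ θ →
      ∀ x y → adj Γ x y ≡ true → (θ x · σ Γ x y) · θ y ≡ σ Δ (g x) (g y)

-- Vertices of the coronas of Γ₁ (n₁ vertices) and Γ₂ (n₂ vertices):
-- u i (original vertices of Γ₁), a i (duplicate vertices), and
-- v i j = the vertex v^i_j of the i-th copy of Γ₂.
data CV (n₁ n₂ : ℕ) : Set where
  u : Fin n₁ → CV n₁ n₂
  a : Fin n₁ → CV n₁ n₂
  v : Fin n₁ → Fin n₂ → CV n₁ n₂

_==_ : ∀ {n} → Fin n → Fin n → Bool
i == k = ⌊ i ≟ k ⌋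

==-sym : ∀ {n} (i k : Fin n) → (i == k) ≡ (k == i)
==-sym i k with i ≟ k | k ≟ i
... | Relation.Nullary.yes _ | Relation.Nullary.yes _ = refl
... | Relation.Nullary.no _  | Relation.Nullary.no _  = refl
... | Relation.Nullary.yes p | Relation.Nullary.no q  = Data.Empty.⊥-elim (q (sym p))
... | Relation.Nullary.no p  | Relation.Nullary.yes q = Data.Empty.⊥-elim (p (sym q))

==-irr : ∀ {n} (i : Fin n) → (i == i) ≡ true
==-irr i with i ≟ i
... | Relation.Nullary.yes _ = refl
... | Relation.Nullary.no p  = Data.Empty.⊥-elim (p refl)

∧-true₂ : ∀ {x y} → (x ∧ y) ≡ true → y ≡ true
∧-true₂ {true} e = e
∧-true₂ {false} ()

module _ {n₁ n₂ : ℕ} (Γ₁ : SignedGraph (Fin n₁)) (Γ₂ : SignedGraph (Fin n₂)) where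

  private
    adj₁ = adj Γ₁
    adj₂ = adj Γ₂
    σ₂ = σ Γ₂
    μ₁ = μ Γ₁
    μ₂ = μ Γ₂

  coronaMarking : CV n₁ n₂ → Sign
  coronaMarking (u i)   = μ₁ i
  coronaMarking (a i)   = μ₁ i
  coronaMarking (v i j) = μ₂ j

  addAdj : CV n₁ n₂ → CV n₁ n₂ → Bool
  addAdj (u i)   (u j)    = false
  addAdj (u i)   (a j)    = adj₁ j i
  addAdj (u i)   (v k j)  = false
  addAdj (a i)   (u j)    = adj₁ i j
  addAdj (a i)   (a j)    = false
  addAdj (a i)   (v k j)  = i == k
  addAdj (v k j) (u i)    = false
  addAdj (v k j) (a i)    = k == i
  addAdj (v k j) (v l m)  = (k == l) ∧ adj₂ j m

  addSig : CV n₁ n₂ → CV n₁ n₂ → Sign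
  addSig (u i)   (a j)    = μ₁ j · μ₁ i
  addSig (a i)   (u j)    = μ₁ i · μ₁ j
  addSig (a i)   (v k j)  = μ₁ i · μ₂ j
  addSig (v k j) (a i)    = μ₁ i · μ₂ j
  addSig (v k j) (v l m)  = σ₂ j m
  addSig _       _        = Sign.+

  addAdj-sym : ∀ x y → addAdj x y ≡ addAdj y x
  addAdj-sym (u i)   (u j)   = refl
  addAdj-sym (u i)   (a j)   = refl
  addAdj-sym (u i)   (v k j) = refl
  addAdj-sym (a i)   (u j)   = refl
  addAdj-sym (a i)   (a j)   = refl
  addAdj-sym (a i)   (v k j) = ==-sym i k
  addAdj-sym (v k j) (u i)   = refl
  addAdj-sym (v k j) (a i)   = ==-sym k i
  addAdj-sym (v k j) (v l m) = cong₂ _∧_ (==-sym k l) (adj-sym Γ₂ j m)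

  addAdj-irr : ∀ x → addAdj x x ≡ false
  addAdj-irr (u i)   = refl
  addAdj-irr (a i)   = refl
  addAdj-irr (v k j) rewrite adj-irr Γ₂ j | ==-irr k = refl

  addSig-sym : ∀ x y → addAdj x y ≡ true → addSig x y ≡ addSig y x
  addSig-sym (u i)   (a j)   _ = refl
  addSig-sym (a i)   (u j)   _ = refl
  addSig-sym (a i)   (v k j) _ = refl
  addSig-sym (v k j) (a i)   _ = refl
  addSig-sym (v k j) (v l m) e = σ-sym Γ₂ j m (∧-true₂ e)
  addSig-sym (u i)   (u j)   ()
  addSig-sym (u i)   (v k j) ()
  addSig-sym (a i)   (a j)   ()
  addSig-sym (v k j) (u i)   ()

  addVertexCorona : SignedGraph (CV n₁ n₂)
  addVertexCorona = record
    { adj = addAdj ; adj-sym = addAdj-sym ; adj-irr = addAdj-irr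
    ; σ = addSig ; σ-sym = addSig-sym ; μ = coronaMarking }

  vtxAdj : CV n₁ n₂ → CV n₁ n₂ → Bool
  vtxAdj (u i)   (u j)    = false
  vtxAdj (u i)   (a j)    = adj₁ j i
  vtxAdj (u i)   (v k j)  = i == k
  vtxAdj (a i)   (u j)    = adj₁ i j
  vtxAdj (a i)   (a j)    = false
  vtxAdj (a i)   (v k j)  = false
  vtxAdj (v k j) (u i)    = k == i
  vtxAdj (v k j) (a i)    = false
  vtxAdj (v k j) (v l m)  = (k == l) ∧ adj₂ j m

  vtxSig : CV n₁ n₂ → CV n₁ n₂ → Sign
  vtxSig (u i)   (a j)    = μ₁ j · μ₁ i
  vtxSig (a i)   (u j)    = μ₁ i · μ₁ j
  vtxSig (u i)   (v k j)  = μ₁ i · μ₂ j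
  vtxSig (v k j) (u i)    = μ₁ i · μ₂ j
  vtxSig (v k j) (v l m)  = σ₂ j m
  vtxSig _       _        = Sign.+

  vtxAdj-sym : ∀ x y → vtxAdj x y ≡ vtxAdj y x
  vtxAdj-sym (u i)   (u j)   = refl
  vtxAdj-sym (u i)   (a j)   = refl
  vtxAdj-sym (u i)   (v k j) = ==-sym i k
  vtxAdj-sym (a i)   (u j)   = refl
  vtxAdj-sym (a i)   (a j)   = refl
  vtxAdj-sym (a i)   (v k j) = refl
  vtxAdj-sym (v k j) (u i)   = ==-sym k i
  vtxAdj-sym (v k j) (a i)   = refl
  vtxAdj-sym (v k j) (v l m) = cong₂ _∧_ (==-sym k l) (adj-sym Γ₂ j m)

  vtxAdj-irr : ∀ x → vtxAdj x x ≡ false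
  vtxAdj-irr (u i)   = refl
  vtxAdj-irr (a i)   = refl
  vtxAdj-irr (v k j) rewrite adj-irr Γ₂ j | ==-irr k = refl

  vtxSig-sym : ∀ x y → vtxAdj x y ≡ true → vtxSig x y ≡ vtxSig y x
  vtxSig-sym (u i)   (a j)   _ = refl
  vtxSig-sym (a i)   (u j)   _ = refl
  vtxSig-sym (u i)   (v k j) _ = refl
  vtxSig-sym (v k j) (u i)   _ = refl
  vtxSig-sym (v k j) (v l m) e = σ-sym Γ₂ j m (∧-true₂ e)
  vtxSig-sym (u i)   (u j)   ()
  vtxSig-sym (a i)   (a j)   ()
  vtxSig-sym (a i)   (v k j) ()
  vtxSig-sym (v k j) (a i)   ()

  vertexCorona : SignedGraph (CV n₁ n₂)
  vertexCorona = record
    { adj = vtxAdj ; adj-sym = vtxAdj-sym ; adj-irr = vtxAdj-irr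
    ; σ = vtxSig ; σ-sym = vtxSig-sym ; μ = coronaMarking }

-- Exchanging each vertex u_i of Γ₁ with its duplicate a_i is a graph isomorphism from
-- Γ₁ ⊛ Γ₂ onto Γ₁ ⊚ Γ₂: in the duplication graph u_i and a_i have mirror neighbourhoods
-- (a_i ~ u_j iff u_i ~ a_j iff u_i u_j ∈ E(G₁)), and both carry the marking μ₁(u_i).
-- Since every edge sign is the product of the markings of its ends, the isomorphism
-- preserves signs outright, so the trivial switching θ ≡ +1 suffices.
module Submission where

open import Defs
open import Data.Nat using (ℕ)
open import Data.Fin using (Fin)
open import Data.Bool using (true)
open import Data.Sign using (Sign) renaming (_*_ to _·_)
open import Data.Sign.Properties using (*-comm; *-identityʳ)
open import Data.Product using (_,_)
open import Function.Bundles using (_↔_; Inverse; mk↔ₛ′)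
open import Relation.Binary.PropositionalEquality using (_≡_; refl; trans)

isomorphic⇒switchingIsomorphic :
  {V W : Set} (Γ : SignedGraph V) (Δ : SignedGraph W) (f : V ↔ W) →
  (∀ x y → adj Δ (Inverse.to f x) (Inverse.to f y) ≡ adj Γ x y) →
  (∀ x y → adj Γ x y ≡ true → σ Γ x y ≡ σ Δ (Inverse.to f x) (Inverse.to f y)) →
  SwitchingIsomorphic Γ Δ
isomorphic⇒switchingIsomorphic Γ Δ f adj-pres σ-pres =
  f , adj-pres , (λ _ → Sign.+) , λ x y xy → trans (*-identityʳ _) (σ-pres x y xy)

swapDuplicates : ∀ {n₁ n₂} → CV n₁ n₂ → CV n₁ n₂
swapDuplicates (u i)   = a i
swapDuplicates (a i)   = u i
swapDuplicates (v k j) = v k j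

swapDuplicates-involutive : ∀ {n₁ n₂} (x : CV n₁ n₂) → swapDuplicates (swapDuplicates x) ≡ x
swapDuplicates-involutive (u i)   = refl
swapDuplicates-involutive (a i)   = refl
swapDuplicates-involutive (v k j) = refl

swapDuplicates-↔ : ∀ {n₁ n₂} → CV n₁ n₂ ↔ CV n₁ n₂
swapDuplicates-↔ = mk↔ₛ′ swapDuplicates swapDuplicates
  swapDuplicates-involutive swapDuplicates-involutive

module _ {n₁ n₂ : ℕ} (Γ₁ : SignedGraph (Fin n₁)) (Γ₂ : SignedGraph (Fin n₂)) where

  vtxAdj-swapDuplicates : ∀ x y →
    vtxAdj Γ₁ Γ₂ (swapDuplicates x) (swapDuplicates y) ≡ addAdj Γ₁ Γ₂ x y
  vtxAdj-swapDuplicates (u i)   (u j)   = refl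
  vtxAdj-swapDuplicates (u i)   (a j)   = adj-sym Γ₁ i j
  vtxAdj-swapDuplicates (u i)   (v k j) = refl
  vtxAdj-swapDuplicates (a i)   (u j)   = adj-sym Γ₁ j i
  vtxAdj-swapDuplicates (a i)   (a j)   = refl
  vtxAdj-swapDuplicates (a i)   (v k j) = refl
  vtxAdj-swapDuplicates (v k j) (u i)   = refl
  vtxAdj-swapDuplicates (v k j) (a i)   = refl
  vtxAdj-swapDuplicates (v k j) (v l m) = refl

  vtxSig-swapDuplicates : ∀ x y → addAdj Γ₁ Γ₂ x y ≡ true →
    addSig Γ₁ Γ₂ x y ≡ vtxSig Γ₁ Γ₂ (swapDuplicates x) (swapDuplicates y)
  vtxSig-swapDuplicates (u i)   (a j)   _ = *-comm (μ Γ₁ j) (μ Γ₁ i)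
  vtxSig-swapDuplicates (a i)   (u j)   _ = *-comm (μ Γ₁ i) (μ Γ₁ j)
  vtxSig-swapDuplicates (a i)   (v k j) _ = refl
  vtxSig-swapDuplicates (v k j) (a i)   _ = refl
  vtxSig-swapDuplicates (v k j) (v l m) _ = refl
  vtxSig-swapDuplicates (u i)   (u j)   ()
  vtxSig-swapDuplicates (u i)   (v k j) ()
  vtxSig-swapDuplicates (a i)   (a j)   ()
  vtxSig-swapDuplicates (v k j) (u i)   ()

mainTheorem3 : {n₁ n₂ : ℕ} (Γ₁ : SignedGraph (Fin n₁)) (Γ₂ : SignedGraph (Fin n₂)) →
    SwitchingIsomorphic (addVertexCorona Γ₁ Γ₂) (vertexCorona Γ₁ Γ₂)
mainTheorem3 Γ₁ Γ₂ =
  isomorphic⇒switchingIsomorphic (addVertexCorona Γ₁ Γ₂) (vertexCorona Γ₁ Γ₂)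
    swapDuplicates-↔ (vtxAdj-swapDuplicates Γ₁ Γ₂) (vtxSig-swapDuplicates Γ₁ Γ₂)
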